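{- Let $G$ be a connected graph embedded on a surface and let $F\subseteq E(G)$ be such that $G[F]$ is connected. Then for every $e\in F$, $$\mu_G(F)-1\le \mu_{G/e}(F^{/e})\le \mu_G(F).$$
   Context: Graphs may have multiple edges and loops. For $B\subseteq E(G)$, $r(B)$ denotes the number of edges of a spanning forest (maximal acyclic subset) of $B$. For $F\subseteq E(G)$, $\mu_G(F):=r(F)+r(E(G)\setminus F)-r(E(G))+1$. $G[F]$ denotes the graph with edge set $F$ and vertex set the endpoints of edges in $F$. For an edge $e=\{u,v\}$, $G/e$ is obtained by deleting $e$ and identifying $u$ and $v$ into a single new vertex (keeping all other edges, possibly creating multiple edges or loops), and $F^{/e}$ denotes the set of edges of $G/e$ corresponding to the edges of $F\setminus\{e\}$. -}

module Defs where

open import Data.Nat using (ℕ; suc)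
open import Data.Integer as ℤ using (ℤ)
open import Data.Bool using (Bool; true; false; not; _∨_; T)
open import Data.Unit using (tt)
open import Data.Empty using (⊥-elim)
open import Data.Fin as Fin using (Fin; punchIn)
open import Data.Fin.Subset using (Subset; _∈_; _∉_; _⊆_; _∪_; ⁅_⁆; ∣_∣)
open import Data.Vec using (tabulate; lookup)
open import Data.List using (List; []; _∷_)
open import Data.List.Relation.Unary.Unique.Propositional using (Unique)
open import Data.Product using (Σ; ∃; ∃-syntax; _×_; _,_; proj₁; proj₂)
open import Data.Sum using (_⊎_)
open import Relation.Nullary using (¬_; yes; no)
open import Relation.Nullary.Decidable using (⌊_⌋)
open import Relation.Binary.PropositionalEquality using (_≡_)
open import Relation.Binary.Definitions using (DecidableEquality)

-- A (finite-edge) multigraph with loops allowed: vertex type V,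
-- edges Fin m, each edge has an (unordered, stored as ordered) pair of ends.
record Graph (V : Set) (m : ℕ) : Set where
  field
    ends : Fin m → V × V
open Graph public

EdgeSet : ℕ → Set
EdgeSet m = Subset m

module _ {V : Set} {m : ℕ} (G : Graph V m) where

  data Step (f : Fin m) (x y : V) : Set where
    fwd : ends G f ≡ (x , y) → Step f x y
    bwd : ends G f ≡ (y , x) → Step f x y

  data Walk (A : EdgeSet m) : V → V → List (Fin m) → Set where
    nil  : ∀ {x} → Walk A x x []
    cons : ∀ {x y z f fs} → f ∈ A → Step f x y → Walk A y z fs → Walk A x z (f ∷ fs)

  HasCycle : EdgeSet m → Set
  HasCycle A = Σ V λ x → Σ (Fin m) λ f → Σ (List (Fin m)) λ fs →
                 Walk A x x (f ∷ fs) × Unique (f ∷ fs)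

  Acyclic : EdgeSet m → Set
  Acyclic A = ¬ HasCycle A

  IsSpanningForest : EdgeSet m → EdgeSet m → Set
  IsSpanningForest B A =
    A ⊆ B × Acyclic A × (∀ f → f ∈ B → f ∉ A → ¬ Acyclic (A ∪ ⁅ f ⁆))

  IsRank : EdgeSet m → ℕ → Set
  IsRank B k = ∃[ A ] (IsSpanningForest B A × ∣ A ∣ ≡ k)

  -- vertex x is an endpoint of some edge of F, i.e. a vertex of G[F]
  IncidentTo : EdgeSet m → V → Set
  IncidentTo F x = ∃[ f ] (f ∈ F × (proj₁ (ends G f) ≡ x ⊎ proj₂ (ends G f) ≡ x))

  Connected : Set
  Connected = ∀ x y → ∃[ fs ] Walk Data.Fin.Subset.⊤ x y fs

  InducedConnected : EdgeSet m → Set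
  InducedConnected F = ∀ x y → IncidentTo F x → IncidentTo F y →
                         ∃[ fs ] Walk F x y fs

-- μ given r(F) = a, r(E∖F) = b, r(E) = c :  a + b - c + 1
μ : ℕ → ℕ → ℕ → ℤ
μ a b c = (ℤ.+ a ℤ.+ ℤ.+ b) ℤ.- ℤ.+ c ℤ.+ ℤ.+ 1

-- Contraction G/e.  Vertices of G/e: the vertices of G, with v removed
-- when e = {u,v} is not a loop (v is identified with u).

module Contraction {V : Set} (_≟_ : DecidableEquality V) where

  CVtx : V → V → Set
  CVtx u v = Σ V λ x → T (not ⌊ x ≟ v ⌋ ∨ ⌊ u ≟ v ⌋)

  private
    lem : ∀ b → T (not b ∨ b)
    lem true  = tt
    lem false = tt

    lem₂ : ∀ {u v x} → ¬ x ≡ v → T (not ⌊ x ≟ v ⌋ ∨ ⌊ u ≟ v ⌋)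
    lem₂ {u} {v} {x} ¬p with x ≟ v
    ... | yes p = ⊥-elim (¬p p)
    ... | no  _ = tt

  φ : (u v : V) → V → CVtx u v
  φ u v x with x ≟ v
  ... | yes _ = u , lem ⌊ u ≟ v ⌋
  ... | no ¬p = x , lem₂ ¬p

  -- G/e : delete e (edges of G/e are Fin k, edge i ↦ punchIn e i of G),
  -- and identify the ends of e
  _/_ : ∀ {k} (G : Graph V (suc k)) (e : Fin (suc k)) →
        Graph (CVtx (proj₁ (ends G e)) (proj₂ (ends G e))) k
  ends (G / e) i =
    let u = proj₁ (ends G e) ; v = proj₂ (ends G e)
        p = ends G (punchIn e i)
    in φ u v (proj₁ p) , φ u v (proj₂ p)


_/_ : ∀ {n k} (G : Graph (Fin n) (suc k)) (e : Fin (suc k)) →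
      Graph (Contraction.CVtx Fin._≟_ (proj₁ (ends G e)) (proj₂ (ends G e))) k
_/_ = Contraction._/_ Fin._≟_

-- F^{/e}: the edges of G/e corresponding to F ∖ {e}
_^/_ : ∀ {k} → Subset (suc k) → Fin (suc k) → Subset k
F ^/ e = tabulate λ i → lookup F (punchIn e i)

-- Edge sets behave as in the graphic matroid: an independent set (no edge has its ends joined
-- by the other edges) all of whose edges are spanned by A₂ has at most ∣ A₂ ∣ edges, by the usual
-- exchange argument.  Comparing spanning forests of G and G / e through this inequality,
-- contracting e leaves r(B) unchanged if e is a loop, lowers it by exactly one if e ∈ B is not
-- a loop, and always lowers it by zero or one.  Since e lies in F and in E(G), the terms r(F)
-- and r(E) drop by the same amount, so μ changes by r_{G/e}(E∖F) − r_G(E∖F) ∈ {−1, 0}.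

module Submission where

open import Defs
open import Data.Nat using (ℕ; suc)
open import Data.Integer using (_≤_; _-_; +_)
open import Data.Fin using (Fin)
open import Data.Fin.Subset using (Subset; _∈_; ∁; ⊤)
open import Data.Product using (_×_)

open import Data.Nat as ℕ using (s≤s; _<_)
open import Data.Nat.Properties using (+-comm; +-suc; ≤-trans; ≤-antisym; m≤n⇒m≤1+n; module ≤-Reasoning)
open import Data.Nat.Induction using (<-wellFounded)
open import Data.Integer as ℤ using (+≤+)
open import Data.Integer.Properties using (+-monoˡ-≤; +-monoʳ-≤)
open import Data.Integer.Tactic.RingSolver using (solve-∀)
open import Data.Bool using (not)
open import Data.Bool.Properties using (T-irrelevant)
open import Data.Vec using ([]; _∷_; here; there; insertAt)
open import Data.Vec.Properties
  using (insertAt-lookup; insertAt-punchIn; []=⇒lookup; lookup⇒[]=; lookup∘tabulate; tabulate-∘;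
         tabulate-cong; tabulate∘lookup; lookup-map; lookup-replicate)
open import Data.Fin as Fin using ()
open import Data.Fin.Properties using (punchIn-punchOut)
open import Data.Fin.Subset using (_∉_; _⊆_; _∪_; _─_; ⁅_⁆; ∣_∣; inside; outside)
open import Data.Fin.Subset.Properties
  using (_∈?_; nonempty?; ∈⊤; x∈p∪q⁺; x∈p∪q⁻; x∈⁅x⁆; x∈⁅y⁆⇒x≡y; p─q⊆p; x∈p∧x∉q⇒x∈p─q;
         x∈p∧x≢y⇒x∈p-y; p⊆q⇒∣p∣≤∣q∣; p⊂q⇒∣p∣<∣q∣; x∈p⇒∣p-x∣<∣p∣; ∣⁅x⁆∣≡1)
open import Data.List using (List; []; _∷_)
open import Data.List.Relation.Unary.Any as Any using (here; there)
open import Data.List.Relation.Unary.All.Properties using (¬Any⇒All¬; All¬⇒¬Any)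
open import Data.List.Relation.Unary.AllPairs using ([]; _∷_)
open import Data.List.Relation.Unary.Unique.Propositional using (Unique)
open import Data.List.Membership.Propositional using (find) renaming (_∈_ to _∈ₗ_; _∉_ to _∉ₗ_)
open import Data.Product using (∃; -,_; _,_; proj₁; proj₂)
open import Data.Sum using (_⊎_; inj₁; inj₂)
open import Data.Empty using (⊥)
open import Function using (_∘_; case_of_)
open import Induction.WellFounded using (Acc; acc)
open import Relation.Nullary using (¬_; yes; no; contradiction)
open import Relation.Nullary.Decidable using (decidable-stable; ¬?)
open import Relation.Binary.PropositionalEquality using (_≡_; _≢_; refl; sym; trans; cong; subst)

x∈p─q⇒x∉q : ∀ {n} {p q : Subset n} {x} → x ∈ p ─ q → x ∉ q
x∈p─q⇒x∉q {p = _ ∷ _} {outside ∷ _} here ()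
x∈p─q⇒x∉q {p = _ ∷ _} {_ ∷ _} (there x∈p─q) (there x∈q) = x∈p─q⇒x∉q x∈p─q x∈q

x∉p─⁅x⁆ : ∀ {n} {p : Subset n} {x} → x ∉ p ─ ⁅ x ⁆
x∉p─⁅x⁆ {x = x} x∈p─⁅x⁆ = x∈p─q⇒x∉q x∈p─⁅x⁆ (x∈⁅x⁆ x)

∣p∪q∣≤∣p∣+∣q∣ : ∀ {n} (p q : Subset n) → ∣ p ∪ q ∣ ℕ.≤ ∣ p ∣ ℕ.+ ∣ q ∣
∣p∪q∣≤∣p∣+∣q∣ [] [] = ℕ.z≤n
∣p∪q∣≤∣p∣+∣q∣ (outside ∷ p) (outside ∷ q) = ∣p∪q∣≤∣p∣+∣q∣ p q
∣p∪q∣≤∣p∣+∣q∣ (outside ∷ p) (inside ∷ q) =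
  subst (suc ∣ p ∪ q ∣ ℕ.≤_) (sym (+-suc ∣ p ∣ ∣ q ∣)) (s≤s (∣p∪q∣≤∣p∣+∣q∣ p q))
∣p∪q∣≤∣p∣+∣q∣ (inside ∷ p) (outside ∷ q) = s≤s (∣p∪q∣≤∣p∣+∣q∣ p q)
∣p∪q∣≤∣p∣+∣q∣ (inside ∷ p) (inside ∷ q) =
  s≤s (subst (∣ p ∪ q ∣ ℕ.≤_) (sym (+-suc ∣ p ∣ ∣ q ∣)) (m≤n⇒m≤1+n (∣p∪q∣≤∣p∣+∣q∣ p q)))

module Walks {V : Set} {m : ℕ} (G : Graph V m) where

  open import Data.List.Membership.DecPropositional (Fin._≟_ {m}) using () renaming (_∈?_ to _∈ₗ?_)

  Joined : EdgeSet m → V → V → Set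
  Joined A x y = ∃ (Walk G A x y)

  Spans : EdgeSet m → Fin m → Set
  Spans A f = Joined A (proj₁ (ends G f)) (proj₂ (ends G f))

  -- ¬ ¬ because maximality of a spanning forest (A ∪ ⁅ f ⁆ is not acyclic) only refutes that f is unspanned.
  SpansAll : EdgeSet m → EdgeSet m → Set
  SpansAll A B = ∀ {f} → f ∈ B → ¬ ¬ Spans A f

  Independent : EdgeSet m → Set
  Independent A = ∀ {f} → f ∈ A → ¬ Spans (A ─ ⁅ f ⁆) f

  step-sym : ∀ {f x y} → Step G f x y → Step G f y x
  step-sym (fwd p) = bwd p
  step-sym (bwd p) = fwd p

  step-ends : ∀ {f x y a b} → Step G f x y → Step G f a b → x ≡ a ⊎ x ≡ b
  step-ends (fwd refl) (fwd refl) = inj₁ refl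
  step-ends (fwd refl) (bwd refl) = inj₂ refl
  step-ends (bwd refl) (fwd refl) = inj₂ refl
  step-ends (bwd refl) (bwd refl) = inj₁ refl

  walk-edges : ∀ {A x y fs h} → Walk G A x y fs → h ∈ₗ fs → h ∈ A
  walk-edges (cons h∈A _ _) (here refl) = h∈A
  walk-edges (cons _ _ w) (there h∈fs) = walk-edges w h∈fs

  walk-retarget : ∀ {A B x y fs} → (∀ {h} → h ∈ₗ fs → h ∈ B) → Walk G A x y fs → Walk G B x y fs
  walk-retarget H nil = nil
  walk-retarget H (cons _ st w) = cons (H (here refl)) st (walk-retarget (H ∘ there) w)

  walk-avoiding : ∀ {A f x y fs} → f ∉ₗ fs → Walk G A x y fs → Walk G (A ─ ⁅ f ⁆) x y fs
  walk-avoiding {f = f} f∉fs w =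
    walk-retarget (λ h∈fs → x∈p∧x≢y⇒x∈p-y (walk-edges w h∈fs) (λ { refl → f∉fs h∈fs })) w

  walk-without : ∀ {A f x y fs} → f ∉ₗ fs → Walk G (A ∪ ⁅ f ⁆) x y fs → Walk G A x y fs
  walk-without {A} {f} {fs = fs} f∉fs w = walk-retarget edge∈A w
    where
    edge∈A : ∀ {h} → h ∈ₗ fs → h ∈ A
    edge∈A h∈fs with x∈p∪q⁻ A ⁅ f ⁆ (walk-edges w h∈fs)
    ... | inj₁ h∈A = h∈A
    ... | inj₂ h∈⁅f⁆ = contradiction (subst (_∈ₗ _) (x∈⁅y⁆⇒x≡y f h∈⁅f⁆) h∈fs) f∉fs

  joined-refl : ∀ {A x} → Joined A x x
  joined-refl = -, nil

  joined-step : ∀ {A f x y} → f ∈ A → Step G f x y → Joined A x y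
  joined-step f∈A st = -, cons f∈A st nil

  walk-joined-trans : ∀ {A x y z fs} → Walk G A x y fs → Joined A y z → Joined A x z
  walk-joined-trans nil q = q
  walk-joined-trans (cons h∈A st w) q = -, cons h∈A st (proj₂ (walk-joined-trans w q))

  joined-trans : ∀ {A x y z} → Joined A x y → Joined A y z → Joined A x z
  joined-trans (_ , w) = walk-joined-trans w

  walk-joined-sym : ∀ {A x y fs} → Walk G A x y fs → Joined A y x
  walk-joined-sym nil = joined-refl
  walk-joined-sym (cons h∈A st w) = joined-trans (walk-joined-sym w) (joined-step h∈A (step-sym st))

  joined-sym : ∀ {A x y} → Joined A x y → Joined A y x
  joined-sym (_ , w) = walk-joined-sym w

  joined-mono : ∀ {A B x y} → A ⊆ B → Joined A x y → Joined B x y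
  joined-mono A⊆B (_ , w) = -, walk-retarget (A⊆B ∘ walk-edges w) w

  spans-self : ∀ {A f} → f ∈ A → Spans A f
  spans-self f∈A = joined-step f∈A (fwd refl)

  spans⇒joined : ∀ {A f x y} → Spans A f → Step G f x y → Joined A x y
  spans⇒joined s (fwd refl) = s
  spans⇒joined s (bwd refl) = joined-sym s

  joined⇒spans : ∀ {A f x y} → Joined A x y → Step G f x y → Spans A f
  joined⇒spans j (fwd refl) = j
  joined⇒spans j (bwd refl) = joined-sym j

  joined-by-spanning : ∀ {A B x y} → (∀ {h} → h ∈ B → Spans A h) → Joined B x y → Joined A x y
  joined-by-spanning {A} {B} H (_ , w) = go w
    where
    go : ∀ {x y fs} → Walk G B x y fs → Joined A x y
    go nil = joined-refl
    go (cons h∈B st w) = joined-trans (spans⇒joined (H h∈B) st) (go w)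

  record Split (A : EdgeSet m) (f : Fin m) (x z : V) : Set where
    field
      a b : V
      pre post : List (Fin m)
      walk-pre : Walk G A x a pre
      step : Step G f a b
      walk-post : Walk G A b z post
      f∉pre : f ∉ₗ pre
      f∉post : f ∉ₗ post
      post-unique : Unique post

  split : ∀ {A f x z fs} → Walk G A x z fs → f ∈ₗ fs → Unique fs → Split A f x z
  split (cons _ st w) (here refl) (f∉fs ∷ fs-unique) = record
    { walk-pre = nil ; step = st ; walk-post = w
    ; f∉pre = λ () ; f∉post = All¬⇒¬Any f∉fs ; post-unique = fs-unique }
  split (cons h∈A st w) (there f∈fs) (h∉fs ∷ fs-unique) = record
    { walk-pre = cons h∈A st walk-pre ; step = step ; walk-post = walk-post
    ; f∉pre = λ { (here refl) → All¬⇒¬Any h∉fs f∈fs ; (there f∈pre) → f∉pre f∈pre }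
    ; f∉post = f∉post ; post-unique = post-unique }
    where
    s = split w f∈fs fs-unique
    open Split s

  shorten : ∀ {A x y fs} → Walk G A x y fs → ∃ λ gs → Walk G A x y gs × Unique gs
  shorten nil = [] , nil , []
  shorten (cons {f = f} f∈A st w) with shorten w
  ... | gs , w′ , gs-unique with f ∈ₗ? gs
  ... | no f∉gs = f ∷ gs , cons f∈A st w′ , ¬Any⇒All¬ gs f∉gs ∷ gs-unique
  ... | yes f∈gs with split w′ f∈gs gs-unique
  ... | record { step = st′ ; walk-post = w″ ; f∉post = f∉post ; post-unique = u }
    with step-ends st st′
  ... | inj₁ refl = -, cons f∈A st′ w″ , ¬Any⇒All¬ _ f∉post ∷ u
  ... | inj₂ refl = -, w″ , u

  acyclic⇒independent : ∀ {A} → Acyclic G A → Independent A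
  acyclic⇒independent {A} acyclic {f} f∈A (_ , w) with shorten w
  ... | gs , w′ , gs-unique =
    acyclic (-, f , gs , cons f∈A (bwd refl) (walk-retarget (p─q⊆p _ _ ∘ walk-edges w′) w′) ,
             ¬Any⇒All¬ gs (x∉p─⁅x⁆ ∘ walk-edges w′) ∷ gs-unique)

  cycle⇒spans : ∀ {A f} → Acyclic G A → f ∉ A → HasCycle G (A ∪ ⁅ f ⁆) → Spans A f
  cycle⇒spans {A} {f} acyclic f∉A (x , h , hs , w , hs-unique) with f ∈ₗ? (h ∷ hs)
  ... | no f∉cycle = contradiction (x , h , hs , walk-without f∉cycle w , hs-unique) acyclic
  ... | yes f∈cycle = joined⇒spans
    (walk-joined-trans (walk-without f∉post walk-post) (-, walk-without f∉pre walk-pre)) (step-sym step)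
    where open Split (split w f∈cycle hs-unique)

  spanning-forest-spans : ∀ {B A} → IsSpanningForest G B A → SpansAll A B
  spanning-forest-spans {A = A} (_ , acyclic , maximal) {f} f∈B with f ∈? A
  ... | yes f∈A = λ ¬spans → ¬spans (spans-self f∈A)
  ... | no f∉A = λ ¬spans → maximal f f∈B f∉A (¬spans ∘ cycle⇒spans acyclic f∉A)

  record Exchange (A₁ A₂ : EdgeSet m) : Set where
    field
      A₂′ : EdgeSet m
      ∣A₂′∣≤∣A₂∣ : ∣ A₂′ ∣ ℕ.≤ ∣ A₂ ∣
      closer : ∣ A₁ ─ A₂′ ∣ < ∣ A₁ ─ A₂ ∣
      spans-A₂ : ∀ {h} → h ∈ A₂ → Spans A₂′ h

  -- Some edge g ∉ A₁ lies on the A₂-path between the ends of f (else A₁ ─ ⁅ f ⁆ spans f); swap g for f.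
  exchange : ∀ {A₁ A₂ f} → Independent A₁ → f ∈ A₁ → f ∉ A₂ → Spans A₂ f → Exchange A₁ A₂
  exchange {A₁} {A₂} {f} independent f∈A₁ f∉A₂ (_ , w) with shorten w
  ... | gs , path , gs-unique with Any.any? (λ g → ¬? (g ∈? A₁)) gs
  ... | no none-outside = contradiction (-, walk-retarget in-A₁-f path) (independent f∈A₁)
    where
    in-A₁-f : ∀ {h} → h ∈ₗ gs → h ∈ A₁ ─ ⁅ f ⁆
    in-A₁-f h∈gs =
      x∈p∧x≢y⇒x∈p-y (decidable-stable (_ ∈? A₁) (λ h∉A₁ → none-outside (Any.map (λ { refl → h∉A₁ }) h∈gs)))
                    (λ { refl → f∉A₂ (walk-edges path h∈gs) })
  ... | yes some-outside with find some-outside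
  ... | g , g∈gs , g∉A₁ = record { A₂′ = A₂′ ; ∣A₂′∣≤∣A₂∣ = size ; closer = closer ; spans-A₂ = spans }
    where
    open Split (split path g∈gs gs-unique)
    open ≤-Reasoning

    A₂′ : EdgeSet m
    A₂′ = (A₂ ─ ⁅ g ⁆) ∪ ⁅ f ⁆

    f∈A₂′ : f ∈ A₂′
    f∈A₂′ = x∈p∪q⁺ (inj₂ (x∈⁅x⁆ f))

    ∈A₂′ : ∀ {h} → h ∈ A₂ → h ≢ g → h ∈ A₂′
    ∈A₂′ h∈A₂ h≢g = x∈p∪q⁺ (inj₁ (x∈p∧x≢y⇒x∈p-y h∈A₂ h≢g))

    size : ∣ A₂′ ∣ ℕ.≤ ∣ A₂ ∣
    size = begin
      ∣ A₂′ ∣                    ≤⟨ ∣p∪q∣≤∣p∣+∣q∣ (A₂ ─ ⁅ g ⁆) ⁅ f ⁆ ⟩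
      ∣ A₂ ─ ⁅ g ⁆ ∣ ℕ.+ ∣ ⁅ f ⁆ ∣   ≡⟨ cong (∣ A₂ ─ ⁅ g ⁆ ∣ ℕ.+_) (∣⁅x⁆∣≡1 f) ⟩
      ∣ A₂ ─ ⁅ g ⁆ ∣ ℕ.+ 1           ≡⟨ +-comm ∣ A₂ ─ ⁅ g ⁆ ∣ 1 ⟩
      suc ∣ A₂ ─ ⁅ g ⁆ ∣             ≤⟨ x∈p⇒∣p-x∣<∣p∣ (walk-edges path g∈gs) ⟩
      ∣ A₂ ∣                     ∎

    closer : ∣ A₁ ─ A₂′ ∣ < ∣ A₁ ─ A₂ ∣
    closer = p⊂q⇒∣p∣<∣q∣ (shrinks , f , x∈p∧x∉q⇒x∈p─q f∈A₁ f∉A₂ , λ f∈ → x∈p─q⇒x∉q f∈ f∈A₂′)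
      where
      shrinks : A₁ ─ A₂′ ⊆ A₁ ─ A₂
      shrinks h∈ = x∈p∧x∉q⇒x∈p─q (p─q⊆p _ _ h∈)
        (λ h∈A₂ → x∈p─q⇒x∉q h∈ (∈A₂′ h∈A₂ (λ { refl → g∉A₁ (p─q⊆p _ _ h∈) })))

    avoiding-g : ∀ {x y fs} → g ∉ₗ fs → Walk G A₂ x y fs → Joined A₂′ x y
    avoiding-g g∉fs w = joined-mono (x∈p∪q⁺ ∘ inj₁) (-, walk-avoiding g∉fs w)

    spans : ∀ {h} → h ∈ A₂ → Spans A₂′ h
    spans {h} h∈A₂ with h Fin.≟ g
    ... | no h≢g = spans-self (∈A₂′ h∈A₂ h≢g)
    ... | yes refl = joined⇒spans
      (joined-trans (joined-sym (avoiding-g f∉pre walk-pre))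
        (joined-trans (joined-step f∈A₂′ (fwd refl)) (joined-sym (avoiding-g f∉post walk-post)))) step

  independent-size-≤ : ∀ {A₁ A₂} → Independent A₁ → SpansAll A₂ A₁ → ∣ A₁ ∣ ℕ.≤ ∣ A₂ ∣
  independent-size-≤ {A₁} independent = go _ (<-wellFounded _)
    where
    go : ∀ A₂ → Acc _<_ ∣ A₁ ─ A₂ ∣ → SpansAll A₂ A₁ → ∣ A₁ ∣ ℕ.≤ ∣ A₂ ∣
    go A₂ (acc rec) spanned with nonempty? (A₁ ─ A₂)
    ... | no empty = p⊆q⇒∣p∣≤∣q∣ λ {f} f∈A₁ →
      decidable-stable (f ∈? A₂) (λ f∉A₂ → empty (f , x∈p∧x∉q⇒x∈p─q f∈A₁ f∉A₂))
    ... | yes (f , f∈A₁─A₂) = decidable-stable (∣ A₁ ∣ ℕ.≤? ∣ A₂ ∣) λ ≰ →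
      spanned (p─q⊆p _ _ f∈A₁─A₂) λ f-spanned →
        let open Exchange (exchange independent (p─q⊆p _ _ f∈A₁─A₂) (x∈p─q⇒x∉q f∈A₁─A₂) f-spanned)
            spanned′ : SpansAll A₂′ A₁
            spanned′ h∈A₁ ¬spans′ = spanned h∈A₁ (¬spans′ ∘ joined-by-spanning spans-A₂)
        in ≰ (≤-trans (go A₂′ (rec closer) spanned′) ∣A₂′∣≤∣A₂∣)

module _ {k : ℕ} (e : Fin (suc k)) where

  ι∈insertAt⁺ : ∀ {S : Subset k} {b i} → i ∈ S → Fin.punchIn e i ∈ insertAt S e b
  ι∈insertAt⁺ {S} {b} {i} i∈S = lookup⇒[]= _ _ (trans (insertAt-punchIn S e b i) ([]=⇒lookup i∈S))

  ι∈insertAt⁻ : ∀ {S : Subset k} {b i} → Fin.punchIn e i ∈ insertAt S e b → i ∈ S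
  ι∈insertAt⁻ {S} {b} {i} ι∈ = lookup⇒[]= _ _ (trans (sym (insertAt-punchIn S e b i)) ([]=⇒lookup ι∈))

  e∈insertAt-inside : ∀ {S : Subset k} → e ∈ insertAt S e inside
  e∈insertAt-inside {S} = lookup⇒[]= _ _ (insertAt-lookup S e inside)

  e∉insertAt-outside : ∀ {S : Subset k} → e ∉ insertAt S e outside
  e∉insertAt-outside {S} e∈ with trans (sym ([]=⇒lookup e∈)) (insertAt-lookup S e outside)
  ... | ()

  ∈^/⁺ : ∀ {B : Subset (suc k)} {i} → Fin.punchIn e i ∈ B → i ∈ B ^/ e
  ∈^/⁺ {B} {i} ι∈B = lookup⇒[]= _ _ (trans (lookup∘tabulate _ i) ([]=⇒lookup ι∈B))

  ∈^/⁻ : ∀ {B : Subset (suc k)} {i} → i ∈ B ^/ e → Fin.punchIn e i ∈ B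
  ∈^/⁻ {B} {i} i∈ = lookup⇒[]= _ _ (trans (sym (lookup∘tabulate _ i)) ([]=⇒lookup i∈))

  ∁-^/ : ∀ (B : Subset (suc k)) → ∁ (B ^/ e) ≡ ∁ B ^/ e
  ∁-^/ B = trans (sym (tabulate-∘ not _)) (tabulate-cong λ i → sym (lookup-map (Fin.punchIn e i) not B))

  ⊤-^/ : ⊤ ^/ e ≡ ⊤
  ⊤-^/ = trans (tabulate-cong λ i → trans (lookup-replicate (Fin.punchIn e i) inside) (sym (lookup-replicate i inside)))
               (tabulate∘lookup ⊤)

∣insertAt-inside∣ : ∀ {k} (S : Subset k) e → ∣ insertAt S e inside ∣ ≡ suc ∣ S ∣
∣insertAt-inside∣ S Fin.zero = refl
∣insertAt-inside∣ (inside ∷ S) (Fin.suc e) = cong suc (∣insertAt-inside∣ S e)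
∣insertAt-inside∣ (outside ∷ S) (Fin.suc e) = ∣insertAt-inside∣ S e

∣insertAt-outside∣ : ∀ {k} (S : Subset k) e → ∣ insertAt S e outside ∣ ≡ ∣ S ∣
∣insertAt-outside∣ S Fin.zero = refl
∣insertAt-outside∣ (inside ∷ S) (Fin.suc e) = cong suc (∣insertAt-outside∣ S e)
∣insertAt-outside∣ (outside ∷ S) (Fin.suc e) = ∣insertAt-outside∣ S e

module Contracting {n k : ℕ} (G : Graph (Fin n) (suc k)) (e : Fin (suc k)) where

  open Contraction (Fin._≟_ {n}) using (CVtx; φ)
  open Walks G
  module W′ = Walks (G / e)

  u v : Fin n
  u = proj₁ (ends G e)
  v = proj₂ (ends G e)

  ι : Fin k → Fin (suc k)
  ι = Fin.punchIn e

  edge-view : ∀ f → f ≡ e ⊎ ∃ λ j → f ≡ ι j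
  edge-view f with f Fin.≟ e
  ... | yes f≡e = inj₁ f≡e
  ... | no f≢e = inj₂ (-, sym (punchIn-punchOut (f≢e ∘ sym)))

  φ-cases : ∀ x → (x ≡ v × proj₁ (φ u v x) ≡ u) ⊎ (x ≢ v × proj₁ (φ u v x) ≡ x)
  φ-cases x with x Fin.≟ v
  ... | yes x≡v = inj₁ (x≡v , refl)
  ... | no x≢v = inj₂ (x≢v , refl)

  CVtx-≡ : ∀ {x y : CVtx u v} → proj₁ x ≡ proj₁ y → x ≡ y
  CVtx-≡ {x , p} {.x , q} refl = cong (x ,_) (T-irrelevant p q)

  φ-identifies-ends : φ u v u ≡ φ u v v
  φ-identifies-ends with φ-cases u | φ-cases v
  ... | _ | inj₂ (v≢v , _) = contradiction refl v≢v
  ... | inj₁ (_ , φu) | inj₁ (_ , φv) = CVtx-≡ (trans φu (sym φv))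
  ... | inj₂ (_ , φu) | inj₁ (_ , φv) = CVtx-≡ (trans φu (sym φv))

  joined-ends : ∀ {B} → e ∈ B ⊎ u ≡ v → Joined B u v
  joined-ends (inj₁ e∈B) = spans-self e∈B
  joined-ends (inj₂ loop) = subst (Joined _ u) loop joined-refl

  φ≡⇒joined : ∀ {B x y} → e ∈ B ⊎ u ≡ v → φ u v x ≡ φ u v y → Joined B x y
  φ≡⇒joined {B} {x} {y} e-collapsible φx≡φy with φ-cases x | φ-cases y
  ... | inj₁ (refl , _) | inj₁ (refl , _) = joined-refl
  ... | inj₁ (refl , φx) | inj₂ (_ , φy) =
    subst (Joined B v) (trans (sym φx) (trans (cong proj₁ φx≡φy) φy)) (joined-sym (joined-ends e-collapsible))
  ... | inj₂ (_ , φx) | inj₁ (refl , φy) =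
    subst (λ z → Joined B z v) (trans (sym φy) (trans (sym (cong proj₁ φx≡φy)) φx)) (joined-ends e-collapsible)
  ... | inj₂ (_ , φx) | inj₂ (_ , φy) =
    subst (Joined B x) (trans (sym φx) (trans (cong proj₁ φx≡φy) φy)) joined-refl

  step-contract : ∀ {j x y} → Step G (ι j) x y → Step (G / e) j (φ u v x) (φ u v y)
  step-contract (fwd refl) = fwd refl
  step-contract (bwd refl) = bwd refl

  step-e-collapses : ∀ {x y} → Step G e x y → φ u v x ≡ φ u v y
  step-e-collapses (fwd refl) = φ-identifies-ends
  step-e-collapses (bwd refl) = sym φ-identifies-ends

  walk-contract : ∀ {B B′ x y fs} → (∀ {i} → ι i ∈ₗ fs → i ∈ B′) → Walk G B x y fs →
                  W′.Joined B′ (φ u v x) (φ u v y)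
  walk-contract H nil = W′.joined-refl
  walk-contract H (cons {f = f} _ st w) with edge-view f
  ... | inj₁ refl = subst (λ z → W′.Joined _ z _) (sym (step-e-collapses st)) (walk-contract (H ∘ there) w)
  ... | inj₂ (_ , refl) =
    W′.joined-trans (W′.joined-step (H (here refl)) (step-contract st)) (walk-contract (H ∘ there) w)

  walk-expand : ∀ {S B X Y fs x y} → e ∈ B ⊎ u ≡ v → (∀ {i} → i ∈ S → ι i ∈ B) →
                Walk (G / e) S X Y fs → φ u v x ≡ X → φ u v y ≡ Y → Joined B x y
  walk-expand e-collapsible H nil φx φy = φ≡⇒joined e-collapsible (trans φx (sym φy))
  walk-expand e-collapsible H (cons i∈S (fwd refl) w) φx φy =
    joined-trans (φ≡⇒joined e-collapsible φx)
      (joined-trans (joined-step (H i∈S) (fwd refl)) (walk-expand e-collapsible H w refl φy))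
  walk-expand e-collapsible H (cons i∈S (bwd refl) w) φx φy =
    joined-trans (φ≡⇒joined e-collapsible φx)
      (joined-trans (joined-step (H i∈S) (bwd refl)) (walk-expand e-collapsible H w refl φy))

  spans-expand : ∀ {S b i} → e ∈ insertAt S e b ⊎ u ≡ v → W′.Spans S i → Spans (insertAt S e b) (ι i)
  spans-expand e-collapsible (_ , w) = walk-expand e-collapsible (ι∈insertAt⁺ e) w refl refl

  independent-insertAt-ι : ∀ {A′ b j} → W′.Independent A′ → ι j ∈ insertAt A′ e b →
                           ¬ Spans (insertAt A′ e b ─ ⁅ ι j ⁆) (ι j)
  independent-insertAt-ι {A′} {j = j} independent ι∈ (fs , w) =
    independent (ι∈insertAt⁻ e ι∈) (walk-contract edge∈A′-j w)
    where
    edge∈A′-j : ∀ {i} → ι i ∈ₗ fs → i ∈ A′ ─ ⁅ j ⁆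
    edge∈A′-j ι∈fs = x∈p∧x≢y⇒x∈p-y (ι∈insertAt⁻ e (p─q⊆p _ _ (walk-edges w ι∈fs)))
                                    (λ { refl → x∉p─⁅x⁆ (walk-edges w ι∈fs) })

  independent-insertAt-outside : ∀ {A′} → W′.Independent A′ → Independent (insertAt A′ e outside)
  independent-insertAt-outside independent {f} f∈ with edge-view f
  ... | inj₁ refl = contradiction f∈ (e∉insertAt-outside e)
  ... | inj₂ (_ , refl) = independent-insertAt-ι independent f∈

  -- The first edge ι j of a u–v path avoiding e would close, in G / e, a cycle through j.
  independent-insertAt-inside : ∀ {A′} → u ≢ v → W′.Independent A′ → Independent (insertAt A′ e inside)
  independent-insertAt-inside {A′} nonloop independent {f} f∈ with edge-view f
  ... | inj₂ (_ , refl) = independent-insertAt-ι independent f∈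
  ... | inj₁ refl = λ (_ , w) → let (_ , path , path-unique) = shorten w in no-path path path-unique refl refl
    where
    no-path : ∀ {x y fs} → Walk G (insertAt A′ e inside ─ ⁅ e ⁆) x y fs → Unique fs → x ≡ u → y ≡ v → ⊥
    no-path nil _ refl y≡v = nonloop y≡v
    no-path (cons {f = h} {fs = fs} h∈ st w) (h∉fs ∷ _) refl refl with edge-view h
    ... | inj₁ refl = x∉p─⁅x⁆ h∈
    ... | inj₂ (j , refl) = independent (ι∈insertAt⁻ e (p─q⊆p _ _ h∈))
      (W′.joined⇒spans
        (W′.joined-sym (subst (W′.Joined _ _) (sym φ-identifies-ends) (walk-contract rest-avoids-j w)))
        (step-contract st))
      where
      rest-avoids-j : ∀ {i} → ι i ∈ₗ fs → i ∈ A′ ─ ⁅ j ⁆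
      rest-avoids-j ι∈fs = x∈p∧x≢y⇒x∈p-y (ι∈insertAt⁻ e (p─q⊆p _ _ (walk-edges w ι∈fs)))
                                          (λ { refl → All¬⇒¬Any h∉fs ι∈fs })

  module _ {B A : EdgeSet (suc k)} {A′ : EdgeSet k}
           (forest : IsSpanningForest G B A) (forest′ : IsSpanningForest (G / e) (B ^/ e) A′) where

    private
      independent : Independent A
      independent = acyclic⇒independent (proj₁ (proj₂ forest))

      independent′ : W′.Independent A′
      independent′ = W′.acyclic⇒independent (proj₁ (proj₂ forest′))

      ι-spanned : ∀ {b j} → ι j ∈ insertAt A′ e b → ¬ ¬ Spans A (ι j)
      ι-spanned ι∈ = spanning-forest-spans forest (∈^/⁻ e (proj₁ forest′ (ι∈insertAt⁻ e ι∈)))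

      spanned-expanded : ∀ {b} → e ∈ insertAt A′ e b ⊎ u ≡ v → ∀ {i} → ι i ∈ A → ¬ ¬ Spans (insertAt A′ e b) (ι i)
      spanned-expanded e-collapsible ι∈A ¬spans =
        W′.spanning-forest-spans forest′ (∈^/⁺ e (proj₁ forest ι∈A)) (¬spans ∘ spans-expand e-collapsible)

    rank-contract-≥ : ∣ A′ ∣ ℕ.≤ ∣ A ∣
    rank-contract-≥ = subst (ℕ._≤ ∣ A ∣) (∣insertAt-outside∣ A′ e)
      (independent-size-≤ (independent-insertAt-outside independent′) spanned)
      where
      spanned : SpansAll A (insertAt A′ e outside)
      spanned {f} f∈ with edge-view f
      ... | inj₁ refl = contradiction f∈ (e∉insertAt-outside e)
      ... | inj₂ (_ , refl) = ι-spanned f∈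

    rank-contract-≤ : ∣ A ∣ ℕ.≤ suc ∣ A′ ∣
    rank-contract-≤ = subst (∣ A ∣ ℕ.≤_) (∣insertAt-inside∣ A′ e) (independent-size-≤ independent spanned)
      where
      spanned : SpansAll (insertAt A′ e inside) A
      spanned {f} f∈A with edge-view f
      ... | inj₁ refl = λ ¬spans → ¬spans (spans-self (e∈insertAt-inside e))
      ... | inj₂ (_ , refl) = spanned-expanded (inj₁ (e∈insertAt-inside e)) f∈A

    rank-contract-bounds : ∣ A′ ∣ ℕ.≤ ∣ A ∣ × ∣ A ∣ ℕ.≤ suc ∣ A′ ∣
    rank-contract-bounds = rank-contract-≥ , rank-contract-≤

    rank-contract-loop : u ≡ v → ∣ A ∣ ≡ ∣ A′ ∣
    rank-contract-loop loop = ≤-antisym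
      (subst (∣ A ∣ ℕ.≤_) (∣insertAt-outside∣ A′ e) (independent-size-≤ independent spanned))
      rank-contract-≥
      where
      spanned : SpansAll (insertAt A′ e outside) A
      spanned {f} f∈A with edge-view f
      ... | inj₁ refl = contradiction (joined-ends (inj₂ loop)) (independent f∈A)
      ... | inj₂ (_ , refl) = spanned-expanded (inj₂ loop) f∈A

    rank-contract-nonloop : u ≢ v → e ∈ B → ∣ A ∣ ≡ suc ∣ A′ ∣
    rank-contract-nonloop nonloop e∈B = ≤-antisym rank-contract-≤
      (subst (ℕ._≤ ∣ A ∣) (∣insertAt-inside∣ A′ e)
        (independent-size-≤ (independent-insertAt-inside nonloop independent′) spanned))
      where
      spanned : SpansAll A (insertAt A′ e inside)
      spanned {f} f∈ with edge-view f
      ... | inj₁ refl = spanning-forest-spans forest e∈B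
      ... | inj₂ (_ , refl) = ι-spanned f∈

μ-suc-suc : ∀ a b c → μ (suc a) b (suc c) ≡ μ a b c
μ-suc-suc a b c = identity (+ a) (+ b) (+ c)
  where
  identity : ∀ x y z → ((+ 1 ℤ.+ x) ℤ.+ y) - (+ 1 ℤ.+ z) ℤ.+ + 1 ≡ (x ℤ.+ y) - z ℤ.+ + 1
  identity = solve-∀

μ-monoᵇ : ∀ a c {b b′} → b ℕ.≤ b′ → μ a b c ≤ μ a b′ c
μ-monoᵇ a c b≤b′ = +-monoˡ-≤ (+ 1) (+-monoˡ-≤ (ℤ.- + c) (+-monoʳ-≤ (+ a) (+≤+ b≤b′)))

μ-pred : ∀ a b c → μ a (suc b) c - + 1 ≡ μ a b c
μ-pred a b c = identity (+ a) (+ b) (+ c)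
  where
  identity : ∀ x y z → (x ℤ.+ (+ 1 ℤ.+ y)) - z ℤ.+ + 1 - + 1 ≡ (x ℤ.+ y) - z ℤ.+ + 1
  identity = solve-∀

μ-bounds : ∀ a c {b b′} → b′ ℕ.≤ b × b ℕ.≤ suc b′ → (μ a b c - + 1 ≤ μ a b′ c) × (μ a b′ c ≤ μ a b c)
μ-bounds a c {b} {b′} (b′≤b , b≤1+b′) =
  subst (μ a b c - + 1 ≤_) (μ-pred a b′ c) (+-monoˡ-≤ (ℤ.- + 1) (μ-monoᵇ a c b≤1+b′)) , μ-monoᵇ a c b′≤b

μ-bounds-loop : ∀ {a b c a′ b′ c′} → a ≡ a′ → c ≡ c′ → b′ ℕ.≤ b × b ℕ.≤ suc b′ →
                (μ a b c - + 1 ≤ μ a′ b′ c′) × (μ a′ b′ c′ ≤ μ a b c)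
μ-bounds-loop {a} {c = c} refl refl = μ-bounds a c

μ-bounds-nonloop : ∀ {a b c a′ b′ c′} → a ≡ suc a′ → c ≡ suc c′ → b′ ℕ.≤ b × b ℕ.≤ suc b′ →
                   (μ a b c - + 1 ≤ μ a′ b′ c′) × (μ a′ b′ c′ ≤ μ a b c)
μ-bounds-nonloop {b = b} {a′ = a′} {c′ = c′} refl refl rewrite μ-suc-suc a′ b c′ = μ-bounds a′ c′

module _ {n k : ℕ} (G : Graph (Fin n) (suc k)) (e : Fin (suc k)) where

  open Contracting G e

  μ-contract-bounds :
    ∀ {F A₁ A₂ A₃ A₁′ A₂′ A₃′} → e ∈ F →
    IsSpanningForest G F A₁ → IsSpanningForest G (∁ F) A₂ → IsSpanningForest G ⊤ A₃ →
    IsSpanningForest (G / e) (F ^/ e) A₁′ → IsSpanningForest (G / e) (∁ F ^/ e) A₂′ →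
    IsSpanningForest (G / e) (⊤ ^/ e) A₃′ →
    (μ (∣ A₁ ∣) (∣ A₂ ∣) (∣ A₃ ∣) - + 1 ≤ μ (∣ A₁′ ∣) (∣ A₂′ ∣) (∣ A₃′ ∣)) ×
    (μ (∣ A₁′ ∣) (∣ A₂′ ∣) (∣ A₃′ ∣) ≤ μ (∣ A₁ ∣) (∣ A₂ ∣) (∣ A₃ ∣))
  μ-contract-bounds e∈F forest₁ forest₂ forest₃ forest₁′ forest₂′ forest₃′ =
    case u Fin.≟ v of λ where
      (yes loop) → μ-bounds-loop
        (rank-contract-loop forest₁ forest₁′ loop)
        (rank-contract-loop forest₃ forest₃′ loop)
        (rank-contract-bounds forest₂ forest₂′)
      (no nonloop) → μ-bounds-nonloop
        (rank-contract-nonloop forest₁ forest₁′ nonloop e∈F)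
        (rank-contract-nonloop forest₃ forest₃′ nonloop ∈⊤)
        (rank-contract-bounds forest₂ forest₂′)

lemma1 : ∀ (n k : ℕ) (G : Graph (Fin n) (suc k)) (F : Subset (suc k)) →
           Connected G → InducedConnected G F →
           ∀ (e : Fin (suc k)) → e ∈ F →
           ∀ (a b c a′ b′ c′ : ℕ) →
           IsRank G F a → IsRank G (∁ F) b → IsRank G ⊤ c →
           IsRank (G / e) (F ^/ e) a′ → IsRank (G / e) (∁ (F ^/ e)) b′ → IsRank (G / e) ⊤ c′ →
           (μ a b c - + 1 ≤ μ a′ b′ c′) × (μ a′ b′ c′ ≤ μ a b c)
lemma1 n k G F _ _ e e∈F _ _ _ _ _ _ (_ , forest₁ , refl) (_ , forest₂ , refl) (_ , forest₃ , refl)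
       (_ , forest₁′ , refl) (_ , forest₂′ , refl) (_ , forest₃′ , refl) =
  μ-contract-bounds G e e∈F forest₁ forest₂ forest₃ forest₁′
    (subst (λ B → IsSpanningForest (G / e) B _) (∁-^/ e F) forest₂′)
    (subst (λ B → IsSpanningForest (G / e) B _) (sym (⊤-^/ e)) forest₃′)
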